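{- Let $p$ be a prime, $r\ge1$, $G=\mathbb{Z}_{p^r}$, let $H$ be a finite abelian group of $p$-rank $t$, and let $k>t$ be an integer. Then \[(1-p^{ -k})\,p^{kr}\le\gamma_k(G,H)\le\frac{p^{k-t}}{p^{k-t}-1}\,p^{kr}.\]
   Context: $\gamma_k(G,H)=\sum_{\vec x\in G^k}|\ker\Gamma_{\vec x}|$, where $\Gamma_{\vec x}:\mathrm{Hom}(G,H)\to H^k$, $\varphi\mapsto(\varphi(x_1),\dots,\varphi(x_k))$; equivalently $\gamma_k=\sum_{\varphi\in\mathrm{Hom}(G,H)}|\ker\varphi|^k$. The $p$-rank of a finite abelian group is the number of cyclic summands of $p$-power order in its decomposition into cyclic groups of prime-power order. -}

module Defs where

open import Data.Nat using (ℕ; zero; suc; _+_; _*_; _^_; _≤_; _∸_; _≟_)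
open import Data.Nat.DivMod using (_mod_)
open import Data.Nat.Primality using (Prime)
open import Data.Fin using (Fin; toℕ) renaming (_≟_ to _≟F_)
import Data.Fin as F
open import Data.Fin.Properties using (all?)
open import Data.Vec using (Vec; []; _∷_; lookup)
open import Data.List using (List; []; _∷_; [_]; map; concatMap; filter; length; allFin)
open import Data.Nat.ListAction using (sum)
open import Data.List.Relation.Unary.All using (All)
open import Data.Product using (_×_; _,_; proj₁; proj₂)
open import Relation.Binary.PropositionalEquality using (_≡_; refl; cong₂)
open import Relation.Nullary using (Dec; yes; no)
open import Relation.Binary using (DecidableEquality)

addMod : ∀ {n} → Fin n → Fin n → Fin n
addMod {suc n} a b = (toℕ a + toℕ b) mod suc n

-- A finite abelian group given by its decomposition into cyclic groups
-- of prime-power order  ℤ_{q₁^{a₁}} ⊕ … ⊕ ℤ_{q_m^{a_m}}.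

Decomp : Set
Decomp = List (ℕ × ℕ)

ValidDecomp : Decomp → Set
ValidDecomp ds = All (λ qa → Prime (proj₁ qa) × (1 ≤ proj₂ qa)) ds

order : ℕ × ℕ → ℕ
order (q , a) = q ^ a

-- elements of ⊕_i ℤ_{1+n_i}, for a list of numbers n_i
-- (the component i lives in Fin (suc n_i), i.e. ℤ modulo 1+n_i)
data Elem : List ℕ → Set where
  nil  : Elem []
  cons : ∀ {n ns} → Fin (suc n) → Elem ns → Elem (n ∷ ns)

-- H = ⊕ ℤ_{q^a}; we store q^a ∸ 1, so the component is Fin (suc (q^a ∸ 1)),
-- which is Fin (q^a) as q^a ≥ 1 for valid decompositions.
moduli : Decomp → List ℕ
moduli = map (λ qa → order qa ∸ 1)

addE : ∀ {ns} → Elem ns → Elem ns → Elem ns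
addE nil nil = nil
addE (cons a x) (cons b y) = cons (addMod a b) (addE x y)

zeroE : ∀ {ns} → Elem ns
zeroE {[]} = nil
zeroE {n ∷ ns} = cons F.zero zeroE

cons-inj : ∀ {n ns} {a b : Fin (suc n)} {x y : Elem ns} → cons a x ≡ cons b y → (a ≡ b) × (x ≡ y)
cons-inj refl = refl , refl

_≟E_ : ∀ {ns} → DecidableEquality (Elem ns)
nil ≟E nil = yes refl
cons a x ≟E cons b y with a ≟F b | x ≟E y
... | yes refl | yes refl = yes refl
... | no a≢b | _ = no (λ e → a≢b (proj₁ (cons-inj e)))
... | yes _ | no x≢y = no (λ e → x≢y (proj₂ (cons-inj e)))

allElem : ∀ ns → List (Elem ns)
allElem [] = [ nil ]
allElem (n ∷ ns) = concatMap (λ a → map (cons a) (allElem ns)) (allFin (suc n))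

Carrier : Decomp → Set
Carrier ds = Elem (moduli ds)

pRank : ℕ → Decomp → ℕ
pRank p ds = length (filter (λ qa → proj₁ qa ≟ p) ds)

allVec : ∀ {A : Set} → List A → ∀ m → List (Vec A m)
allVec xs zero = [ [] ]
allVec xs (suc m) = concatMap (λ x → map (x ∷_) (allVec xs m)) xs

IsHom : ∀ N ds → Vec (Carrier ds) N → Set
IsHom N ds φ = ∀ (x y : Fin N) → lookup φ (addMod x y) ≡ addE (lookup φ x) (lookup φ y)

isHom? : ∀ N ds (φ : Vec (Carrier ds) N) → Dec (IsHom N ds φ)
isHom? N ds φ = all? (λ x → all? (λ y → lookup φ (addMod x y) ≟E addE (lookup φ x) (lookup φ y)))

Hom : ∀ N ds → List (Vec (Carrier ds) N)
Hom N ds = filter (isHom? N ds) (allVec (allElem (moduli ds)) N)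

kerSize : ∀ {N ds} → Vec (Carrier ds) N → ℕ
kerSize {N} φ = length (filter (λ x → lookup φ x ≟E zeroE) (allFin N))

γ : ℕ → ℕ → Decomp → ℕ
γ k N ds = sum (map (λ φ → kerSize φ ^ k) (Hom N ds))

-- A homomorphism φ : ℤ_(p^r) → H is determined by h = φ(1), and if h has order p^c then ker φ = p^c ℤ_(p^r)
-- has p^(r-c) elements.  Hence |ker φ|^k ≤ Σ_{b ≤ r} p^(k(r-b)) [p^b h = 0], and summing over h,
-- γ_k ≤ Σ_{b ≤ r} p^(k(r-b)) |H[p^b]| ≤ Σ_{b ≤ r} p^(k(r-b)) p^(bt): a cyclic summand ℤ_(p^a) of H has at most
-- p^b elements killed by p^b, and a summand of order prime to p only one.  This geometric series with ratio
-- p^(t-k) is at most p^(kr) p^(k-t) / (p^(k-t) - 1).  The lower bound is the term p^(kr) of the zero homomorphism.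

module Submission where

open import Defs
open import Data.Nat
open import Data.Nat.Properties
open import Data.Nat.DivMod using (_%_; _/_; %-distribˡ-+; m%n%n≡m%n; m<n⇒m%n≡m; m≡m%n+[m/n]*n; n%n≡0)
open import Data.Nat.Divisibility using (_∣_; _∣?_; divides; 1∣_; ∣1⇒≡1; *-cancelˡ-∣; m%n≡0⇒n∣m; n∣m⇒m%n≡0)
open import Data.Nat.Coprimality using (Coprime; coprime-divisor)
open import Data.Nat.GCD using (module Bézout; module GCD)
open import Data.Nat.Primality using (Prime; prime⇒nonZero; prime⇒nonTrivial; prime⇒irreducible; euclidsLemma)
open import Data.Nat.Solver using (module +-*-Solver)
open import Algebra.Properties.CommutativeSemigroup +-commutativeSemigroup using () renaming (interchange to +-interchange)
open import Data.Nat.ListAction using (sum)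
open import Data.Fin using (Fin; toℕ; fromℕ<) renaming (zero to fzero; suc to fsuc; _≟_ to _≟F_)
open import Data.Fin.Properties using (toℕ-injective; toℕ-fromℕ<; toℕ<n; fromℕ<-toℕ) renaming (suc-injective to fsuc-injective)
open import Data.List using (List; []; _∷_; map; concatMap; filter; length; allFin; _++_)
open import Data.List.Properties using (map-tabulate; filter-accept; filter-reject; filter-all; length-tabulate)
open import Data.List.Relation.Unary.All using ([]; _∷_; universal)
open import Data.Vec using (Vec; []; _∷_; lookup; tabulate; replicate)
open import Data.Vec.Properties using (≡-dec; ∷-injective; tabulate∘lookup; tabulate-cong; lookup-replicate)
open import Data.Product using (Σ; _×_; _,_; proj₁; proj₂)
open import Data.Sum using (_⊎_; inj₁; inj₂)
open import Data.Empty using (⊥-elim)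
open import Function using (_∘_; _∘′_; id)
open import Relation.Binary using (DecidableEquality)
open import Relation.Binary.PropositionalEquality
open import Relation.Nullary using (Dec; yes; no; ¬_; contradiction)
open import Relation.Unary using (Pred; Decidable)

private
  variable
    ns : List ℕ

-- Indicators and finite sums

𝟙 : ∀ {a} {P : Set a} → Dec P → ℕ
𝟙 (yes _) = 1
𝟙 (no _)  = 0

𝟙-mono : ∀ {a b} {P : Set a} {Q : Set b} (d : Dec P) (e : Dec Q) → (P → Q) → 𝟙 d ≤ 𝟙 e
𝟙-mono (yes p) (yes _) _ = ≤-refl
𝟙-mono (yes p) (no ¬q) f = ⊥-elim (¬q (f p))
𝟙-mono (no _)  _       _ = z≤n

𝟙-cong : ∀ {a b} {P : Set a} {Q : Set b} (d : Dec P) (e : Dec Q) → (P → Q) → (Q → P) → 𝟙 d ≡ 𝟙 e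
𝟙-cong d e f g = ≤-antisym (𝟙-mono d e f) (𝟙-mono e d g)

𝟙-yes : ∀ {a} {P : Set a} (d : Dec P) → P → 𝟙 d ≡ 1
𝟙-yes (yes _) _ = refl
𝟙-yes (no ¬p) p = ⊥-elim (¬p p)

𝟙-no : ∀ {a} {P : Set a} (d : Dec P) → ¬ P → 𝟙 d ≡ 0
𝟙-no (yes p) ¬p = ⊥-elim (¬p p)
𝟙-no (no _)  _  = refl

𝟙≤1 : ∀ {a} {P : Set a} (d : Dec P) → 𝟙 d ≤ 1
𝟙≤1 (yes _) = ≤-refl
𝟙≤1 (no _)  = z≤n

𝟙*≤ : ∀ {a} {P : Set a} (d : Dec P) n → 𝟙 d * n ≤ n
𝟙*≤ (yes _) n = ≤-reflexive (+-identityʳ n)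
𝟙*≤ (no _)  n = z≤n

𝟙-× : ∀ {a b c} {P : Set a} {Q : Set b} {R : Set c} (d : Dec P) (e : Dec Q) (f : Dec R) →
      (P → Q × R) → (Q → R → P) → 𝟙 d ≡ 𝟙 e * 𝟙 f
𝟙-× d (yes q) (yes r) _  g = 𝟙-yes d (g q r)
𝟙-× d (yes _) (no ¬r) to _ = 𝟙-no d (¬r ∘ proj₂ ∘ to)
𝟙-× d (no ¬q) _       to _ = 𝟙-no d (¬q ∘ proj₁ ∘ to)

∑ : ∀ {A : Set} → List A → (A → ℕ) → ℕ
∑ xs f = sum (map f xs)

infix 5 ∑
syntax ∑ xs (λ x → e) = ∑[ x ∈ xs ] e

module _ {A : Set} where

  length-filter : ∀ {ℓ} {P : Pred A ℓ} (P? : Decidable P) xs → length (filter P? xs) ≡ ∑[ x ∈ xs ] 𝟙 (P? x)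
  length-filter P? [] = refl
  length-filter P? (x ∷ xs) with P? x
  ... | yes _ = cong suc (length-filter P? xs)
  ... | no _  = length-filter P? xs

  ∑-filter : ∀ {ℓ} {P : Pred A ℓ} (P? : Decidable P) (f : A → ℕ) xs →
             ∑ (filter P? xs) f ≡ ∑[ x ∈ xs ] 𝟙 (P? x) * f x
  ∑-filter P? f [] = refl
  ∑-filter P? f (x ∷ xs) with P? x
  ... | yes _ = cong₂ _+_ (sym (+-identityʳ (f x))) (∑-filter P? f xs)
  ... | no _  = ∑-filter P? f xs

  ∑-cong : ∀ {f g : A → ℕ} → (∀ x → f x ≡ g x) → ∀ xs → ∑ xs f ≡ ∑ xs g
  ∑-cong f≗g [] = refl
  ∑-cong f≗g (x ∷ xs) = cong₂ _+_ (f≗g x) (∑-cong f≗g xs)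

  ∑-mono : ∀ {f g : A → ℕ} → (∀ x → f x ≤ g x) → ∀ xs → ∑ xs f ≤ ∑ xs g
  ∑-mono f≤g [] = z≤n
  ∑-mono f≤g (x ∷ xs) = +-mono-≤ (f≤g x) (∑-mono f≤g xs)

  ∑-zero : ∀ (xs : List A) → ∑[ _ ∈ xs ] 0 ≡ 0
  ∑-zero [] = refl
  ∑-zero (_ ∷ xs) = ∑-zero xs

  ∑-++ : ∀ (f : A → ℕ) xs ys → ∑ (xs ++ ys) f ≡ ∑ xs f + ∑ ys f
  ∑-++ f [] ys = refl
  ∑-++ f (x ∷ xs) ys = trans (cong (f x +_) (∑-++ f xs ys)) (sym (+-assoc (f x) _ _))

  ∑-+ : ∀ (f g : A → ℕ) xs → ∑[ x ∈ xs ] (f x + g x) ≡ ∑ xs f + ∑ xs g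
  ∑-+ f g [] = refl
  ∑-+ f g (x ∷ xs) = begin
    f x + g x + (∑[ y ∈ xs ] (f y + g y)) ≡⟨ cong (f x + g x +_) (∑-+ f g xs) ⟩
    f x + g x + (∑ xs f + ∑ xs g)         ≡⟨ +-interchange (f x) (g x) (∑ xs f) (∑ xs g) ⟩
    f x + ∑ xs f + (g x + ∑ xs g)         ∎
    where open ≡-Reasoning

  ∑-*ˡ : ∀ c (f : A → ℕ) xs → ∑[ x ∈ xs ] c * f x ≡ c * ∑ xs f
  ∑-*ˡ c f [] = sym (*-zeroʳ c)
  ∑-*ˡ c f (x ∷ xs) = trans (cong (c * f x +_) (∑-*ˡ c f xs)) (sym (*-distribˡ-+ c (f x) (∑ xs f)))

  ∑-*ʳ : ∀ c (f : A → ℕ) xs → ∑[ x ∈ xs ] f x * c ≡ ∑ xs f * c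
  ∑-*ʳ c f xs = trans (∑-cong (λ x → *-comm (f x) c) xs) (trans (∑-*ˡ c f xs) (*-comm c (∑ xs f)))

module _ {A B : Set} where

  ∑-map : ∀ (f : B → ℕ) (g : A → B) xs → ∑ (map g xs) f ≡ ∑ xs (f ∘ g)
  ∑-map f g [] = refl
  ∑-map f g (x ∷ xs) = cong (f (g x) +_) (∑-map f g xs)

  ∑-concatMap : ∀ (f : B → ℕ) (g : A → List B) xs → ∑ (concatMap g xs) f ≡ ∑[ x ∈ xs ] ∑ (g x) f
  ∑-concatMap f g [] = refl
  ∑-concatMap f g (x ∷ xs) = trans (∑-++ f (g x) (concatMap g xs)) (cong (∑ (g x) f +_) (∑-concatMap f g xs))

  ∑-swap : ∀ (f : A → B → ℕ) xs ys → ∑[ x ∈ xs ] ∑[ y ∈ ys ] f x y ≡ ∑[ y ∈ ys ] ∑[ x ∈ xs ] f x y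
  ∑-swap f [] ys = sym (∑-zero ys)
  ∑-swap f (x ∷ xs) ys = trans (cong (∑ ys (f x) +_) (∑-swap f xs ys))
                               (sym (∑-+ (f x) (λ y → ∑[ x′ ∈ xs ] f x′ y) ys))

∑-product : ∀ {A B C : Set} (c : A → B → C) xs ys (h : C → ℕ) (f : A → ℕ) (g : B → ℕ) →
            (∀ a b → h (c a b) ≡ f a * g b) →
            ∑ (concatMap (λ a → map (c a) ys) xs) h ≡ ∑ xs f * ∑ ys g
∑-product c xs ys h f g h≡f*g = begin
  ∑ (concatMap (λ a → map (c a) ys) xs) h ≡⟨ ∑-concatMap h (λ a → map (c a) ys) xs ⟩
  ∑[ a ∈ xs ] ∑ (map (c a) ys) h           ≡⟨ ∑-cong row xs ⟩
  ∑[ a ∈ xs ] f a * ∑ ys g                 ≡⟨ ∑-*ʳ (∑ ys g) f xs ⟩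
  ∑ xs f * ∑ ys g                         ∎
  where
  open ≡-Reasoning
  row : ∀ a → ∑ (map (c a) ys) h ≡ f a * ∑ ys g
  row a = trans (∑-map h (c a) ys) (trans (∑-cong (h≡f*g a) ys) (∑-*ˡ (f a) g ys))

∑-allFin-suc : ∀ {n} (f : Fin (suc n) → ℕ) → ∑ (allFin (suc n)) f ≡ f fzero + ∑ (allFin n) (f ∘ fsuc)
∑-allFin-suc f = cong (λ xs → f fzero + sum xs) (trans (map-tabulate fsuc f) (sym (map-tabulate id (f ∘ fsuc))))

record Enumerates {A : Set} (_≟_ : DecidableEquality A) (xs : List A) : Set where
  field
    occurs-once : ∀ a → ∑[ x ∈ xs ] 𝟙 (x ≟ a) ≡ 1

open Enumerates

module _ {A : Set} {_≟_ : DecidableEquality A} {xs : List A} (enum : Enumerates _≟_ xs) where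

  ∑-pick : ∀ (f : A → ℕ) a → ∑[ x ∈ xs ] 𝟙 (x ≟ a) * f x ≡ f a
  ∑-pick f a = begin
    ∑[ x ∈ xs ] 𝟙 (x ≟ a) * f x ≡⟨ ∑-cong 𝟙*f≡𝟙*fa xs ⟩
    ∑[ x ∈ xs ] 𝟙 (x ≟ a) * f a ≡⟨ ∑-*ʳ (f a) (λ x → 𝟙 (x ≟ a)) xs ⟩
    (∑[ x ∈ xs ] 𝟙 (x ≟ a)) * f a ≡⟨ cong (_* f a) (occurs-once enum a) ⟩
    1 * f a                     ≡⟨ *-identityˡ (f a) ⟩
    f a                         ∎
    where
    open ≡-Reasoning
    𝟙*f≡𝟙*fa : ∀ x → 𝟙 (x ≟ a) * f x ≡ 𝟙 (x ≟ a) * f a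
    𝟙*f≡𝟙*fa x with x ≟ a
    ... | yes refl = refl
    ... | no _     = refl

enumerates-product : ∀ {A B C : Set} {_≟A_ : DecidableEquality A} {_≟B_ : DecidableEquality B} (_≟C_ : DecidableEquality C)
                     (c : A → B → C) → (∀ {a a′ b b′} → c a b ≡ c a′ b′ → a ≡ a′ × b ≡ b′) →
                     ∀ {xs ys} → Enumerates _≟A_ xs → Enumerates _≟B_ ys →
                     ∀ a b → ∑[ z ∈ concatMap (λ a → map (c a) ys) xs ] 𝟙 (z ≟C c a b) ≡ 1
enumerates-product {_≟A_ = _≟A_} {_≟B_} _≟C_ c c-injective {xs} {ys} enum-xs enum-ys a b =
  trans (∑-product c xs ys (λ z → 𝟙 (z ≟C c a b)) (λ a′ → 𝟙 (a′ ≟A a)) (λ b′ → 𝟙 (b′ ≟B b)) 𝟙-pair)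
        (cong₂ _*_ (occurs-once enum-xs a) (occurs-once enum-ys b))
  where
  𝟙-pair : ∀ a′ b′ → 𝟙 (c a′ b′ ≟C c a b) ≡ 𝟙 (a′ ≟A a) * 𝟙 (b′ ≟B b)
  𝟙-pair a′ b′ = 𝟙-× (c a′ b′ ≟C c a b) (a′ ≟A a) (b′ ≟B b) c-injective (λ { refl refl → refl })

allFin-enumerates : ∀ n → Enumerates _≟F_ (allFin n)
allFin-enumerates (suc n) .occurs-once fzero = begin
  ∑ (allFin (suc n)) (λ x → 𝟙 (x ≟F fzero))   ≡⟨ ∑-allFin-suc {n} (λ x → 𝟙 (x ≟F fzero)) ⟩
  1 + (∑[ x ∈ allFin n ] 𝟙 (fsuc x ≟F fzero)) ≡⟨ cong suc (∑-cong (λ x → 𝟙-no (fsuc x ≟F fzero) λ ()) (allFin n)) ⟩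
  1 + (∑[ x ∈ allFin n ] 0)                    ≡⟨ cong suc (∑-zero (allFin n)) ⟩
  1                                            ∎
  where open ≡-Reasoning
allFin-enumerates (suc n) .occurs-once (fsuc a) = begin
  ∑ (allFin (suc n)) (λ x → 𝟙 (x ≟F fsuc a))   ≡⟨ ∑-allFin-suc {n} (λ x → 𝟙 (x ≟F fsuc a)) ⟩
  ∑[ x ∈ allFin n ] 𝟙 (fsuc x ≟F fsuc a)       ≡⟨ ∑-cong (λ x → 𝟙-cong (fsuc x ≟F fsuc a) (x ≟F a) fsuc-injective (cong fsuc)) (allFin n) ⟩
  ∑[ x ∈ allFin n ] 𝟙 (x ≟F a)                 ≡⟨ occurs-once (allFin-enumerates n) a ⟩
  1                                             ∎
  where open ≡-Reasoning

allElem-enumerates : ∀ ns → Enumerates _≟E_ (allElem ns)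
allElem-enumerates [] .occurs-once nil = refl
allElem-enumerates (n ∷ ns) .occurs-once (cons a x) =
  enumerates-product _≟E_ cons cons-inj (allFin-enumerates (suc n)) (allElem-enumerates ns) a x

allVec-enumerates : ∀ {A : Set} {_≟_ : DecidableEquality A} {xs} → Enumerates _≟_ xs →
                    ∀ m → Enumerates (≡-dec _≟_) (allVec xs m)
allVec-enumerates enum zero .occurs-once [] = refl
allVec-enumerates {_≟_ = _≟_} enum (suc m) .occurs-once (x ∷ v) =
  enumerates-product (≡-dec _≟_) _∷_ ∷-injective enum (allVec-enumerates enum m) x v

∑< : ℕ → (ℕ → ℕ) → ℕ
∑< zero    f = 0
∑< (suc n) f = ∑< n f + f n

infix 5 ∑<
syntax ∑< n (λ x → e) = ∑[ x < n ] e

∑<-suc : ∀ n (f : ℕ → ℕ) → ∑< (suc n) f ≡ f 0 + ∑< n (f ∘ suc)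
∑<-suc zero    f = +-comm 0 (f 0)
∑<-suc (suc n) f = trans (cong (_+ f (suc n)) (∑<-suc n f)) (+-assoc (f 0) (∑< n (f ∘ suc)) (f (suc n)))

∑-allFin-toℕ : ∀ n (f : ℕ → ℕ) → ∑[ i ∈ allFin n ] f (toℕ i) ≡ ∑< n f
∑-allFin-toℕ zero    f = refl
∑-allFin-toℕ (suc n) f = begin
  ∑[ i ∈ allFin (suc n) ] f (toℕ i) ≡⟨ ∑-allFin-suc {n} (f ∘ toℕ) ⟩
  f 0 + (∑[ i ∈ allFin n ] f (suc (toℕ i))) ≡⟨ cong (f 0 +_) (∑-allFin-toℕ n (f ∘ suc)) ⟩
  f 0 + ∑< n (f ∘ suc)              ≡⟨ ∑<-suc n f ⟨
  ∑< (suc n) f                      ∎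
  where open ≡-Reasoning

∑<-mono : ∀ {f g : ℕ → ℕ} → (∀ x → f x ≤ g x) → ∀ n → ∑< n f ≤ ∑< n g
∑<-mono f≤g zero    = z≤n
∑<-mono f≤g (suc n) = +-mono-≤ (∑<-mono f≤g n) (f≤g n)

count<≤ : ∀ {ℓ} {P : Pred ℕ ℓ} (P? : Decidable P) n → ∑[ x < n ] 𝟙 (P? x) ≤ n
count<≤ P? zero    = z≤n
count<≤ P? (suc n) = ≤-trans (+-mono-≤ (count<≤ P? n) (𝟙≤1 (P? n))) (≤-reflexive (+-comm n 1))

-- Induction on c with the invariant  (#multiples of d below c) * d < c + d.
count-multiples≤ : ∀ d .{{_ : NonZero d}} q → ∑[ x < q * d ] 𝟙 (d ∣? x) ≤ q
count-multiples≤ d q = s≤s⁻¹ (*-cancelʳ-< d _ (suc q) (subst (count< (q * d) * d <_) (+-comm (q * d) d) (invariant (q * d))))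
  where
  count< : ℕ → ℕ
  count< c = ∑[ x < c ] 𝟙 (d ∣? x)
  invariant : ∀ c → count< c * d < c + d
  invariant zero = >-nonZero⁻¹ d
  invariant (suc c) with d ∣? c | invariant c
  ... | no _ | ih = begin-strict
    (count< c + 0) * d ≡⟨ cong (_* d) (+-identityʳ (count< c)) ⟩
    count< c * d       <⟨ ih ⟩
    c + d              <⟨ n<1+n (c + d) ⟩
    suc c + d          ∎
    where open ≤-Reasoning
  ... | yes (divides b refl) | ih = begin-strict
    (count< (b * d) + 1) * d ≤⟨ *-monoˡ-≤ d count<1+b ⟩
    suc b * d                ≡⟨ +-comm d (b * d) ⟩
    b * d + d                <⟨ n<1+n (b * d + d) ⟩
    suc (b * d) + d          ∎
    where
    open ≤-Reasoning
    count<1+b : count< (b * d) + 1 ≤ suc b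
    count<1+b = subst (_≤ suc b) (+-comm 1 _) (*-cancelʳ-< d _ (suc b) (subst (count< (b * d) * d <_) (+-comm (b * d) d) ih))

-- The groups ℤ_n and H

module _ {n : ℕ} where
  private
    M = suc n

  toℕ-addMod : (a b : Fin M) → toℕ (addMod a b) ≡ (toℕ a + toℕ b) % M
  toℕ-addMod a b = toℕ-fromℕ< _

  [m%n+o]%n≡[m+o]%n : ∀ m o → (m % M + o) % M ≡ (m + o) % M
  [m%n+o]%n≡[m+o]%n m o = begin
    (m % M + o) % M       ≡⟨ %-distribˡ-+ (m % M) o M ⟩
    (m % M % M + o % M) % M ≡⟨ cong (λ z → (z + o % M) % M) (m%n%n≡m%n m M) ⟩
    (m % M + o % M) % M   ≡⟨ %-distribˡ-+ m o M ⟨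
    (m + o) % M           ∎
    where open ≡-Reasoning

  [m+o%n]%n≡[m+o]%n : ∀ m o → (m + o % M) % M ≡ (m + o) % M
  [m+o%n]%n≡[m+o]%n m o = begin
    (m + o % M) % M ≡⟨ cong (_% M) (+-comm m (o % M)) ⟩
    (o % M + m) % M ≡⟨ [m%n+o]%n≡[m+o]%n o m ⟩
    (o + m) % M     ≡⟨ cong (_% M) (+-comm o m) ⟩
    (m + o) % M     ∎
    where open ≡-Reasoning

  addMod-comm : (a b : Fin M) → addMod a b ≡ addMod b a
  addMod-comm a b = toℕ-injective (begin
    toℕ (addMod a b)      ≡⟨ toℕ-addMod a b ⟩
    (toℕ a + toℕ b) % M   ≡⟨ cong (_% M) (+-comm (toℕ a) (toℕ b)) ⟩
    (toℕ b + toℕ a) % M   ≡⟨ toℕ-addMod b a ⟨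
    toℕ (addMod b a)      ∎)
    where open ≡-Reasoning

  addMod-assoc : (a b c : Fin M) → addMod (addMod a b) c ≡ addMod a (addMod b c)
  addMod-assoc a b c = toℕ-injective (begin
    toℕ (addMod (addMod a b) c)       ≡⟨ toℕ-addMod (addMod a b) c ⟩
    (toℕ (addMod a b) + toℕ c) % M    ≡⟨ cong (λ z → (z + toℕ c) % M) (toℕ-addMod a b) ⟩
    ((toℕ a + toℕ b) % M + toℕ c) % M ≡⟨ [m%n+o]%n≡[m+o]%n (toℕ a + toℕ b) (toℕ c) ⟩
    (toℕ a + toℕ b + toℕ c) % M       ≡⟨ cong (_% M) (+-assoc (toℕ a) (toℕ b) (toℕ c)) ⟩
    (toℕ a + (toℕ b + toℕ c)) % M     ≡⟨ [m+o%n]%n≡[m+o]%n (toℕ a) (toℕ b + toℕ c) ⟨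
    (toℕ a + (toℕ b + toℕ c) % M) % M ≡⟨ cong (λ z → (toℕ a + z) % M) (toℕ-addMod b c) ⟨
    (toℕ a + toℕ (addMod b c)) % M    ≡⟨ toℕ-addMod a (addMod b c) ⟨
    toℕ (addMod a (addMod b c))       ∎)
    where open ≡-Reasoning

  addMod-identityˡ : (a : Fin M) → addMod fzero a ≡ a
  addMod-identityˡ a = toℕ-injective (trans (toℕ-addMod fzero a) (m<n⇒m%n≡m (toℕ<n a)))

  -- a + a ≡ a + q·M with a < M forces q = 0 and a = 0.
  addMod-idem⇒zero : (a : Fin M) → addMod a a ≡ a → a ≡ fzero
  addMod-idem⇒zero a a+a≡a = toℕ-injective (a≡qM⇒a≡0 ((toℕ a + toℕ a) / M) a≡qM)
    where
    a≡qM : toℕ a ≡ (toℕ a + toℕ a) / M * M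
    a≡qM = +-cancelˡ-≡ (toℕ a) (toℕ a) _ (begin
      toℕ a + toℕ a                                   ≡⟨ m≡m%n+[m/n]*n (toℕ a + toℕ a) M ⟩
      (toℕ a + toℕ a) % M + (toℕ a + toℕ a) / M * M    ≡⟨ cong (_+ (toℕ a + toℕ a) / M * M) (trans (sym (toℕ-addMod a a)) (cong toℕ a+a≡a)) ⟩
      toℕ a + (toℕ a + toℕ a) / M * M                  ∎)
      where open ≡-Reasoning
    a≡qM⇒a≡0 : ∀ q → toℕ a ≡ q * M → toℕ a ≡ 0
    a≡qM⇒a≡0 zero    a≡0  = a≡0
    a≡qM⇒a≡0 (suc q) a≡qM = contradiction (subst (_< M) a≡qM (toℕ<n a)) (≤⇒≯ (m≤m+n M (q * M)))

addE-comm : (x y : Elem ns) → addE x y ≡ addE y x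
addE-comm nil        nil        = refl
addE-comm (cons a x) (cons b y) = cong₂ cons (addMod-comm a b) (addE-comm x y)

addE-assoc : (x y z : Elem ns) → addE (addE x y) z ≡ addE x (addE y z)
addE-assoc nil        nil        nil        = refl
addE-assoc (cons a x) (cons b y) (cons c z) = cong₂ cons (addMod-assoc a b c) (addE-assoc x y z)

addE-identityˡ : (x : Elem ns) → addE zeroE x ≡ x
addE-identityˡ nil        = refl
addE-identityˡ (cons a x) = cong₂ cons (addMod-identityˡ a) (addE-identityˡ x)

addE-identityʳ : (x : Elem ns) → addE x zeroE ≡ x
addE-identityʳ x = trans (addE-comm x zeroE) (addE-identityˡ x)

addE-idem⇒zero : (x : Elem ns) → addE x x ≡ x → x ≡ zeroE
addE-idem⇒zero nil        _     = refl
addE-idem⇒zero (cons a x) x+x≡x =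
  cong₂ cons (addMod-idem⇒zero a (proj₁ (cons-inj x+x≡x))) (addE-idem⇒zero x (proj₂ (cons-inj x+x≡x)))

infixr 7 _·ᶠ_ _·_

_·ᶠ_ : ∀ {n} → ℕ → Fin (suc n) → Fin (suc n)
zero  ·ᶠ a = fzero
suc k ·ᶠ a = addMod a (k ·ᶠ a)

toℕ-·ᶠ : ∀ {n} k (a : Fin (suc n)) → toℕ (k ·ᶠ a) ≡ (k * toℕ a) % suc n
toℕ-·ᶠ zero    a = refl
toℕ-·ᶠ (suc k) a = begin
  toℕ (addMod a (k ·ᶠ a))      ≡⟨ toℕ-addMod a (k ·ᶠ a) ⟩
  (toℕ a + toℕ (k ·ᶠ a)) % _   ≡⟨ cong (λ z → (toℕ a + z) % _) (toℕ-·ᶠ k a) ⟩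
  (toℕ a + (k * toℕ a) % _) % _ ≡⟨ [m+o%n]%n≡[m+o]%n (toℕ a) (k * toℕ a) ⟩
  (toℕ a + k * toℕ a) % _      ∎
  where open ≡-Reasoning

_·_ : ℕ → Elem ns → Elem ns
zero  · h = zeroE
suc k · h = addE h (k · h)

·-distribʳ-+ : ∀ a b (h : Elem ns) → (a + b) · h ≡ addE (a · h) (b · h)
·-distribʳ-+ zero    b h = sym (addE-identityˡ (b · h))
·-distribʳ-+ (suc a) b h = trans (cong (addE h) (·-distribʳ-+ a b h)) (sym (addE-assoc h (a · h) (b · h)))

·-assoc : ∀ a b (h : Elem ns) → (a * b) · h ≡ a · b · h
·-assoc zero    b h = refl
·-assoc (suc a) b h = trans (·-distribʳ-+ b (a * b) h) (cong (addE (b · h)) (·-assoc a b h))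

·-zeroʳ : ∀ k → k · zeroE {ns} ≡ zeroE
·-zeroʳ zero    = refl
·-zeroʳ (suc k) = trans (cong (addE zeroE) (·-zeroʳ k)) (addE-identityˡ zeroE)

·-cons : ∀ {n} k (a : Fin (suc n)) (x : Elem ns) → k · cons a x ≡ cons (k ·ᶠ a) (k · x)
·-cons zero    a x = refl
·-cons (suc k) a x = cong (addE (cons a x)) (·-cons k a x)

-- Divisors of prime powers and orders of elements

module _ {p : ℕ} (p-prime : Prime p) where
  private
    instance
      p≢0 : NonZero p
      p≢0 = prime⇒nonZero p-prime

  ¬p∣⇒coprime : ∀ {c} → ¬ p ∣ c → Coprime c p
  ¬p∣⇒coprime {c} p∤c {e} (e∣c , e∣p) with prime⇒irreducible p-prime e∣p
  ... | inj₁ e≡1 = e≡1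
  ... | inj₂ e≡p = ⊥-elim (p∤c (subst (_∣ c) e≡p e∣c))

  ∣p^b∧¬p∣⇒≡1 : ∀ b {c} → c ∣ p ^ b → ¬ p ∣ c → c ≡ 1
  ∣p^b∧¬p∣⇒≡1 zero    c∣1   _   = ∣1⇒≡1 c∣1
  ∣p^b∧¬p∣⇒≡1 (suc b) c∣p^b p∤c = ∣p^b∧¬p∣⇒≡1 b (coprime-divisor (¬p∣⇒coprime p∤c) c∣p^b) p∤c

  ∣p^[1+b]⇒≡∨∣p^b : ∀ b {d} → d ∣ p ^ suc b → d ≡ p ^ suc b ⊎ d ∣ p ^ b
  ∣p^[1+b]⇒≡∨∣p^b b {d} (divides c p^[1+b]≡c*d) with p ∣? c
  ... | yes (divides c′ refl) = inj₂ (divides c′ (*-cancelˡ-≡ (p ^ b) (c′ * d) p (begin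
    p * p ^ b     ≡⟨ p^[1+b]≡c*d ⟩
    c′ * p * d    ≡⟨ cong (_* d) (*-comm c′ p) ⟩
    p * c′ * d    ≡⟨ *-assoc p c′ d ⟩
    p * (c′ * d)  ∎)))
    where open ≡-Reasoning
  ... | no p∤c = inj₁ (begin
    d         ≡⟨ *-identityˡ d ⟨
    1 * d     ≡⟨ cong (_* d) (∣p^b∧¬p∣⇒≡1 (suc b) (divides d (trans p^[1+b]≡c*d (*-comm c d))) p∤c) ⟨
    c * d     ≡⟨ p^[1+b]≡c*d ⟨
    p ^ suc b ∎)
    where open ≡-Reasoning

  p∣q^a⇒p∣q : ∀ {q} a → p ∣ q ^ a → p ∣ q
  p∣q^a⇒p∣q zero    p∣1   = ⊥-elim (nonTrivial⇒≢1 {{prime⇒nonTrivial p-prime}} (∣1⇒≡1 p∣1))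
  p∣q^a⇒p∣q {q} (suc a) p∣q^[1+a] with euclidsLemma q (q ^ a) p-prime p∣q^[1+a]
  ... | inj₁ p∣q   = p∣q
  ... | inj₂ p∣q^a = p∣q^a⇒p∣q a p∣q^a

  q^a∣p^j*c⇒q^a∣c : ∀ {q} a → Prime q → q ≢ p → ∀ j c → q ^ a ∣ p ^ j * c → q ^ a ∣ c
  q^a∣p^j*c⇒q^a∣c a q-prime q≢p zero    c q^a∣c   = subst (_ ∣_) (+-identityʳ c) q^a∣c
  q^a∣p^j*c⇒q^a∣c {q} a q-prime q≢p (suc j) c q^a∣p^[1+j]c =
    q^a∣p^j*c⇒q^a∣c a q-prime q≢p j c (coprime-divisor q^a⊥p (subst (q ^ a ∣_) (*-assoc p (p ^ j) c) q^a∣p^[1+j]c))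
    where
    p∤q : ¬ p ∣ q
    p∤q p∣q with prime⇒irreducible q-prime p∣q
    ... | inj₁ p≡1 = nonTrivial⇒≢1 {{prime⇒nonTrivial p-prime}} p≡1
    ... | inj₂ p≡q = q≢p (sym p≡q)
    q^a⊥p : Coprime (q ^ a) p
    q^a⊥p = ¬p∣⇒coprime (p∤q ∘′ p∣q^a⇒p∣q a)

module _ {h : Elem ns} where

  kills-* : ∀ a x → x · h ≡ zeroE → (a * x) · h ≡ zeroE
  kills-* a x x·h≡0 = begin
    (a * x) · h ≡⟨ ·-assoc a x h ⟩
    a · x · h   ≡⟨ cong (a ·_) x·h≡0 ⟩
    a · zeroE   ≡⟨ ·-zeroʳ a ⟩
    zeroE       ∎
    where open ≡-Reasoning

  kills-+ʳ : ∀ d y → y · h ≡ zeroE → (d + y) · h ≡ d · h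
  kills-+ʳ d y y·h≡0 = begin
    (d + y) · h             ≡⟨ ·-distribʳ-+ d y h ⟩
    addE (d · h) (y · h)    ≡⟨ cong (addE (d · h)) y·h≡0 ⟩
    addE (d · h) zeroE      ≡⟨ addE-identityʳ (d · h) ⟩
    d · h                   ∎
    where open ≡-Reasoning

  kills-Bézout : ∀ {d x y} → x · h ≡ zeroE → y · h ≡ zeroE → Bézout.Identity d x y → d · h ≡ zeroE
  kills-Bézout {d} {x} {y} x·h≡0 y·h≡0 (Bézout.+- a b d+by≡ax) = begin
    d · h           ≡⟨ kills-+ʳ d (b * y) (kills-* b y y·h≡0) ⟨
    (d + b * y) · h ≡⟨ cong (_· h) d+by≡ax ⟩
    (a * x) · h     ≡⟨ kills-* a x x·h≡0 ⟩
    zeroE           ∎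
    where open ≡-Reasoning
  kills-Bézout {d} {x} {y} x·h≡0 y·h≡0 (Bézout.-+ a b d+ax≡by) = begin
    d · h           ≡⟨ kills-+ʳ d (a * x) (kills-* a x x·h≡0) ⟨
    (d + a * x) · h ≡⟨ cong (_· h) d+ax≡by ⟩
    (b * y) · h     ≡⟨ kills-* b y y·h≡0 ⟩
    zeroE           ∎
    where open ≡-Reasoning

-- For prime p this says that h has order exactly p ^ c.
record OrderExponent (p : ℕ) (h : Elem ns) (c : ℕ) : Set where
  field
    kills   : p ^ c · h ≡ zeroE
    minimal : ∀ b → c ≡ suc b → p ^ b · h ≢ zeroE

order-exponent : ∀ p (h : Elem ns) r → p ^ r · h ≡ zeroE → Σ ℕ λ c → c ≤ r × OrderExponent p h c
order-exponent p h zero    p^0·h≡0 = 0 , z≤n , record { kills = p^0·h≡0 ; minimal = λ _ () }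
order-exponent p h (suc r) p^[1+r]·h≡0 with (p ^ r · h) ≟E zeroE
... | yes p^r·h≡0 = let c , c≤r , order = order-exponent p h r p^r·h≡0 in c , m≤n⇒m≤1+n c≤r , order
... | no p^r·h≢0  = suc r , ≤-refl , record { kills = p^[1+r]·h≡0 ; minimal = λ { _ refl → p^r·h≢0 } }

order-exponent-∣ : ∀ {p} → Prime p → ∀ {h : Elem ns} {c} → OrderExponent p h c → ∀ x → x · h ≡ zeroE → p ^ c ∣ x
order-exponent-∣ {p = p} p-prime {h} {c} order x x·h≡0 with Bézout.lemma x (p ^ c)
... | Bézout.result d gcd identity = p^c∣x c refl
  where
  open OrderExponent order
  d∣x = proj₁ (GCD.commonDivisor gcd)
  d∣p^c = proj₂ (GCD.commonDivisor gcd)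
  d·h≡0 : d · h ≡ zeroE
  d·h≡0 = kills-Bézout x·h≡0 kills identity
  p^c∣x : ∀ c′ → c′ ≡ c → p ^ c′ ∣ x
  p^c∣x zero    _    = 1∣ x
  p^c∣x (suc b) refl with ∣p^[1+b]⇒≡∨∣p^b p-prime b d∣p^c
  ... | inj₁ d≡p^c         = subst (_∣ x) d≡p^c d∣x
  ... | inj₂ (divides e p^b≡ed) = ⊥-elim (minimal b refl (trans (cong (_· h) p^b≡ed) (kills-* e d d·h≡0)))

-- Homomorphisms out of ℤ_N

zero-isHom : ∀ N ds → IsHom N ds (replicate N zeroE)
zero-isHom N ds x y = begin
  lookup (replicate N zeroE) (addMod x y)                        ≡⟨ lookup-replicate (addMod x y) zeroE ⟩
  zeroE                                                          ≡⟨ addE-identityˡ zeroE ⟨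
  addE zeroE zeroE                                               ≡⟨ cong₂ addE (lookup-replicate x zeroE) (lookup-replicate y zeroE) ⟨
  addE (lookup (replicate N zeroE) x) (lookup (replicate N zeroE) y) ∎
  where open ≡-Reasoning

module Homomorphism {m : ℕ} {ds : Decomp} (φ : Vec (Carrier ds) (2 + m)) (φ-hom : IsHom (2 + m) ds φ) where

  private
    N = 2 + m

    one : Fin N
    one = fsuc fzero

    toℕ-addMod-one : ∀ a → toℕ (addMod a one) ≡ suc (toℕ a) % N
    toℕ-addMod-one a = trans (toℕ-addMod a one) (cong (_% N) (+-comm (toℕ a) 1))

  generator : Carrier ds
  generator = lookup φ one

  φ-zero : lookup φ fzero ≡ zeroE
  φ-zero = addE-idem⇒zero (lookup φ fzero) (begin
    addE (lookup φ fzero) (lookup φ fzero) ≡⟨ φ-hom fzero fzero ⟨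
    lookup φ (addMod fzero fzero)          ≡⟨ cong (lookup φ) (addMod-identityˡ fzero) ⟩
    lookup φ fzero                         ∎)
    where open ≡-Reasoning

  φ-fromℕ< : ∀ s (s<N : s < N) → lookup φ (fromℕ< s<N) ≡ s · generator
  φ-fromℕ< zero    _       = φ-zero
  φ-fromℕ< (suc s) 1+s<N = begin
    lookup φ (fromℕ< 1+s<N)                   ≡⟨ cong (lookup φ) fromℕ<-suc ⟩
    lookup φ (addMod (fromℕ< s<N) one)        ≡⟨ φ-hom (fromℕ< s<N) one ⟩
    addE (lookup φ (fromℕ< s<N)) generator    ≡⟨ cong (λ z → addE z generator) (φ-fromℕ< s s<N) ⟩
    addE (s · generator) generator            ≡⟨ addE-comm (s · generator) generator ⟩
    suc s · generator                         ∎
    where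
    open ≡-Reasoning
    s<N = <-trans (n<1+n s) 1+s<N
    fromℕ<-suc : fromℕ< 1+s<N ≡ addMod (fromℕ< s<N) one
    fromℕ<-suc = toℕ-injective (begin
      toℕ (fromℕ< 1+s<N)                 ≡⟨ toℕ-fromℕ< 1+s<N ⟩
      suc s                              ≡⟨ m<n⇒m%n≡m 1+s<N ⟨
      suc s % N                          ≡⟨ cong (λ z → suc z % N) (toℕ-fromℕ< s<N) ⟨
      suc (toℕ (fromℕ< s<N)) % N         ≡⟨ toℕ-addMod-one (fromℕ< s<N) ⟨
      toℕ (addMod (fromℕ< s<N) one)      ∎)

  φ-· : ∀ i → lookup φ i ≡ toℕ i · generator
  φ-· i = trans (cong (lookup φ) (sym (fromℕ<-toℕ i (toℕ<n i)))) (φ-fromℕ< (toℕ i) (toℕ<n i))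

  φ≡tabulate : φ ≡ tabulate (λ i → toℕ i · generator)
  φ≡tabulate = trans (sym (tabulate∘lookup φ)) (tabulate-cong φ-·)

  N·generator≡0 : N · generator ≡ zeroE
  N·generator≡0 = begin
    addE generator ((1 + m) · generator)     ≡⟨ cong (addE generator) (φ-fromℕ< (1 + m) last<N) ⟨
    addE generator (lookup φ last)           ≡⟨ addE-comm generator (lookup φ last) ⟩
    addE (lookup φ last) generator           ≡⟨ φ-hom last one ⟨
    lookup φ (addMod last one)               ≡⟨ cong (lookup φ) last+1≡0 ⟩
    lookup φ fzero                           ≡⟨ φ-zero ⟩
    zeroE                                    ∎
    where
    open ≡-Reasoning
    last<N = n<1+n (1 + m)
    last = fromℕ< last<N
    last+1≡0 : addMod last one ≡ fzero
    last+1≡0 = toℕ-injective (trans (toℕ-addMod-one last) (trans (cong (λ z → suc z % N) (toℕ-fromℕ< last<N)) (n%n≡0 N)))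

-- Elements of H killed by p^j

#killed : ℕ → List ℕ → ℕ
#killed P ns = ∑[ h ∈ allElem ns ] 𝟙 ((P · h) ≟E zeroE)

#killed-ℤ : ℕ → ℕ → ℕ
#killed-ℤ P n = ∑[ a ∈ allFin (suc n) ] 𝟙 ((P ·ᶠ a) ≟F fzero)

#killed-cons : ∀ P n ns → #killed P (n ∷ ns) ≡ #killed-ℤ P n * #killed P ns
#killed-cons P n ns = ∑-product cons (allFin (suc n)) (allElem ns) killed killedᶠ killed λ a x →
  𝟙-× ((P · cons a x) ≟E zeroE) ((P ·ᶠ a) ≟F fzero) ((P · x) ≟E zeroE)
      (λ P·ax≡0 → cons-inj (trans (sym (·-cons P a x)) P·ax≡0))
      (λ P·a≡0 P·x≡0 → trans (·-cons P a x) (cong₂ cons P·a≡0 P·x≡0))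
  where
  killed : ∀ {ns} → Elem ns → ℕ
  killed h = 𝟙 ((P · h) ≟E zeroE)
  killedᶠ : Fin (suc n) → ℕ
  killedᶠ a = 𝟙 ((P ·ᶠ a) ≟F fzero)

#killed-ℤ≡ : ∀ P n → #killed-ℤ P n ≡ ∑[ x < suc n ] 𝟙 (suc n ∣? P * x)
#killed-ℤ≡ P n = trans (∑-cong 𝟙-killed≡𝟙-∣ (allFin (suc n))) (∑-allFin-toℕ (suc n) (λ x → 𝟙 (suc n ∣? P * x)))
  where
  𝟙-killed≡𝟙-∣ : ∀ a → 𝟙 ((P ·ᶠ a) ≟F fzero) ≡ 𝟙 (suc n ∣? P * toℕ a)
  𝟙-killed≡𝟙-∣ a = 𝟙-cong ((P ·ᶠ a) ≟F fzero) (suc n ∣? P * toℕ a)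
    (λ P·a≡0 → m%n≡0⇒n∣m (P * toℕ a) (suc n) (trans (sym (toℕ-·ᶠ P a)) (cong toℕ P·a≡0)))
    (λ n+1∣Pa → toℕ-injective (trans (toℕ-·ᶠ P a) (n∣m⇒m%n≡0 (P * toℕ a) (suc n) n+1∣Pa)))

module _ {p q a : ℕ} (ds : Decomp) where

  pRank-accept : q ≡ p → pRank p ((q , a) ∷ ds) ≡ suc (pRank p ds)
  pRank-accept q≡p = cong length (filter-accept (λ (qa : ℕ × ℕ) → proj₁ qa ≟ p) {x = q , a} {xs = ds} q≡p)

  pRank-reject : q ≢ p → pRank p ((q , a) ∷ ds) ≡ pRank p ds
  pRank-reject q≢p = cong length (filter-reject (λ (qa : ℕ × ℕ) → proj₁ qa ≟ p) {x = q , a} {xs = ds} q≢p)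

module _ {p : ℕ} (p-prime : Prime p) (j : ℕ) where
  private
    instance
      p≢0 : NonZero p
      p≢0 = prime⇒nonZero p-prime

  #killed-ℤ-p^a : ∀ a → ∑[ x < p ^ a ] 𝟙 (p ^ a ∣? p ^ j * x) ≤ p ^ j
  #killed-ℤ-p^a a with a ≤? j
  ... | yes a≤j = ≤-trans (count<≤ (λ x → p ^ a ∣? p ^ j * x) (p ^ a)) (^-monoʳ-≤ p a≤j)
  ... | no  a≰j = begin
    ∑[ x < p ^ a ] 𝟙 (p ^ a ∣? p ^ j * x)       ≤⟨ ∑<-mono (λ x → 𝟙-mono (p ^ a ∣? p ^ j * x) (p ^ e ∣? x) (cancel x)) (p ^ a) ⟩
    ∑[ x < p ^ a ] 𝟙 (p ^ e ∣? x)               ≡⟨ cong (λ n → ∑[ x < n ] 𝟙 (p ^ e ∣? x)) p^a≡p^j*p^e ⟩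
    ∑[ x < p ^ j * p ^ e ] 𝟙 (p ^ e ∣? x)       ≤⟨ count-multiples≤ (p ^ e) {{m^n≢0 p e}} (p ^ j) ⟩
    p ^ j                                       ∎
    where
    open ≤-Reasoning
    e = a ∸ j
    p^a≡p^j*p^e : p ^ a ≡ p ^ j * p ^ e
    p^a≡p^j*p^e = trans (cong (p ^_) (sym (m+[n∸m]≡n (<⇒≤ (≰⇒> a≰j))))) (^-distribˡ-+-* p j e)
    cancel : ∀ x → p ^ a ∣ p ^ j * x → p ^ e ∣ x
    cancel x p^a∣p^jx = *-cancelˡ-∣ (p ^ j) {{m^n≢0 p j}} (subst (_∣ p ^ j * x) p^a≡p^j*p^e p^a∣p^jx)

  #killed-ℤ-q^a : ∀ {q} a → Prime q → q ≢ p → ∑[ x < q ^ a ] 𝟙 (q ^ a ∣? p ^ j * x) ≤ 1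
  #killed-ℤ-q^a {q} a q-prime q≢p = begin
    ∑[ x < q ^ a ] 𝟙 (q ^ a ∣? p ^ j * x) ≤⟨ ∑<-mono (λ x → 𝟙-mono (q ^ a ∣? p ^ j * x) (q ^ a ∣? x) (cancel x)) (q ^ a) ⟩
    ∑[ x < q ^ a ] 𝟙 (q ^ a ∣? x)         ≡⟨ cong (λ n → ∑[ x < n ] 𝟙 (q ^ a ∣? x)) (*-identityˡ (q ^ a)) ⟨
    ∑[ x < 1 * q ^ a ] 𝟙 (q ^ a ∣? x)     ≤⟨ count-multiples≤ (q ^ a) {{m^n≢0 q a {{prime⇒nonZero q-prime}}}} 1 ⟩
    1                                     ∎
    where
    open ≤-Reasoning
    cancel = q^a∣p^j*c⇒q^a∣c p-prime a q-prime q≢p j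

  #killed-component : ∀ q a → Prime q → #killed-ℤ (p ^ j) (q ^ a ∸ 1) ≡ ∑[ x < q ^ a ] 𝟙 (q ^ a ∣? p ^ j * x)
  #killed-component q a q-prime = trans (#killed-ℤ≡ (p ^ j) (q ^ a ∸ 1))
    (cong (λ M → ∑[ x < M ] 𝟙 (M ∣? p ^ j * x)) (m+[n∸m]≡n (m^n>0 q {{prime⇒nonZero q-prime}} a)))

  #killed≤ : ∀ ds → ValidDecomp ds → #killed (p ^ j) (moduli ds) ≤ (p ^ j) ^ pRank p ds
  #killed≤ [] [] = ≤-trans (≤-reflexive (+-identityʳ _)) (𝟙≤1 _)
  #killed≤ ((q , a) ∷ ds) ((q-prime , _) ∷ valid) with q ≟ p
  ... | yes refl = begin
    #killed (p ^ j) (moduli ((q , a) ∷ ds))                ≡⟨ #killed-cons (p ^ j) (q ^ a ∸ 1) (moduli ds) ⟩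
    #killed-ℤ (p ^ j) (q ^ a ∸ 1) * #killed (p ^ j) (moduli ds) ≤⟨ *-mono-≤ component (#killed≤ ds valid) ⟩
    p ^ j * (p ^ j) ^ pRank p ds                           ≡⟨ cong ((p ^ j) ^_) (pRank-accept ds refl) ⟨
    (p ^ j) ^ pRank p ((q , a) ∷ ds)                       ∎
    where
    open ≤-Reasoning
    component = ≤-trans (≤-reflexive (#killed-component q a q-prime)) (#killed-ℤ-p^a a)
  ... | no q≢p = begin
    #killed (p ^ j) (moduli ((q , a) ∷ ds))                ≡⟨ #killed-cons (p ^ j) (q ^ a ∸ 1) (moduli ds) ⟩
    #killed-ℤ (p ^ j) (q ^ a ∸ 1) * #killed (p ^ j) (moduli ds) ≤⟨ *-mono-≤ component (#killed≤ ds valid) ⟩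
    1 * (p ^ j) ^ pRank p ds                               ≡⟨ *-identityˡ _ ⟩
    (p ^ j) ^ pRank p ds                                   ≡⟨ cong ((p ^ j) ^_) (pRank-reject ds q≢p) ⟨
    (p ^ j) ^ pRank p ((q , a) ∷ ds)                       ∎
    where
    open ≤-Reasoning
    component = ≤-trans (≤-reflexive (#killed-component q a q-prime)) (#killed-ℤ-q^a a q-prime q≢p)

-- Horner sums

^-swap : ∀ m n o → (m ^ n) ^ o ≡ (m ^ o) ^ n
^-swap m n o = trans (^-*-assoc m n o) (trans (cong (m ^_) (*-comm n o)) (sym (^-*-assoc m o n)))

-- horner P f r = Σ_{b ≤ r} P ^ (r ∸ b) * f b
horner : ℕ → (ℕ → ℕ) → ℕ → ℕ
horner P f zero    = f 0
horner P f (suc r) = P * horner P f r + f (suc r)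

horner-term : ∀ P f r b → b ≤ r → P ^ (r ∸ b) * f b ≤ horner P f r
horner-term P f zero    zero    _   = ≤-reflexive (+-identityʳ (f 0))
horner-term P f (suc r) b       b≤1+r with m≤n⇒m<n∨m≡n b≤1+r
... | inj₂ refl = begin
  P ^ (r ∸ r) * f (suc r) ≡⟨ cong (λ e → P ^ e * f (suc r)) (n∸n≡0 r) ⟩
  1 * f (suc r)           ≡⟨ *-identityˡ (f (suc r)) ⟩
  f (suc r)               ≤⟨ m≤n+m (f (suc r)) (P * horner P f r) ⟩
  P * horner P f r + f (suc r) ∎
  where open ≤-Reasoning
... | inj₁ (s≤s b≤r) = begin
  P ^ (suc r ∸ b) * f b   ≡⟨ cong (λ e → P ^ e * f b) (+-∸-assoc 1 b≤r) ⟩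
  P * P ^ (r ∸ b) * f b   ≡⟨ *-assoc P (P ^ (r ∸ b)) (f b) ⟩
  P * (P ^ (r ∸ b) * f b) ≤⟨ *-monoʳ-≤ P (horner-term P f r b b≤r) ⟩
  P * horner P f r        ≤⟨ m≤m+n (P * horner P f r) (f (suc r)) ⟩
  P * horner P f r + f (suc r) ∎
  where open ≤-Reasoning

horner-mono : ∀ P {f g : ℕ → ℕ} → (∀ b → f b ≤ g b) → ∀ r → horner P f r ≤ horner P g r
horner-mono P f≤g zero    = f≤g 0
horner-mono P f≤g (suc r) = +-mono-≤ (*-monoʳ-≤ P (horner-mono P f≤g r)) (f≤g (suc r))

∑-horner : ∀ {A : Set} P (F : A → ℕ → ℕ) xs r → ∑[ x ∈ xs ] horner P (F x) r ≡ horner P (λ b → ∑[ x ∈ xs ] F x b) r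
∑-horner P F xs zero    = refl
∑-horner P F xs (suc r) = begin
  ∑[ x ∈ xs ] (P * horner P (F x) r + F x (suc r))                ≡⟨ ∑-+ (λ x → P * horner P (F x) r) (λ x → F x (suc r)) xs ⟩
  (∑[ x ∈ xs ] P * horner P (F x) r) + (∑[ x ∈ xs ] F x (suc r))  ≡⟨ cong (_+ _) (∑-*ˡ P (λ x → horner P (F x) r) xs) ⟩
  P * (∑[ x ∈ xs ] horner P (F x) r) + (∑[ x ∈ xs ] F x (suc r))  ≡⟨ cong (λ s → P * s + _) (∑-horner P F xs r) ⟩
  P * horner P (λ b → ∑[ x ∈ xs ] F x b) r + (∑[ x ∈ xs ] F x (suc r)) ∎
  where open ≡-Reasoning

-- The geometric series Σ_{b ≤ r} P^(r-b) T^b with ratio T/P = 1/(1+m), multiplied out so that no subtraction occurs.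
horner-geometric : ∀ T m r → m * horner (T * suc m) (T ^_) r + T ^ r ≡ suc m * (T * suc m) ^ r
horner-geometric T m zero    = solve 1 (λ m → m :* con 1 :+ con 1 := (con 1 :+ m) :* con 1) refl m
  where open +-*-Solver
horner-geometric T m (suc r) = begin
  m * (P * horner P (T ^_) r + T * T ^ r) + T * T ^ r ≡⟨ solve 4 (λ m t s u → m :* (t :* (con 1 :+ m) :* s :+ t :* u) :+ t :* u
                                                                  := t :* (con 1 :+ m) :* (m :* s :+ u)) refl m T (horner P (T ^_) r) (T ^ r) ⟩
  P * (m * horner P (T ^_) r + T ^ r)                 ≡⟨ cong (P *_) (horner-geometric T m r) ⟩
  P * (suc m * P ^ r)                                 ≡⟨ solve 3 (λ m p q → p :* ((con 1 :+ m) :* q) := (con 1 :+ m) :* (p :* q)) refl m P (P ^ r) ⟩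
  suc m * (P * P ^ r)                                 ∎
  where
  open ≡-Reasoning
  open +-*-Solver
  P = T * suc m

geometric-bound : ∀ T Q P r → P ≡ T * Q → 1 ≤ Q → (Q ∸ 1) * horner P (T ^_) r ≤ Q * P ^ r
geometric-bound T (suc m) _ r refl _ = ≤-trans (m≤m+n _ (T ^ r)) (≤-reflexive (horner-geometric T m r))

-- The bounds on γ

kerSize-zero : ∀ N ds → kerSize {N} {ds} (replicate N zeroE) ≡ N
kerSize-zero N ds = trans (cong length (filter-all _ all-zero)) (length-tabulate id)
  where
  all-zero = universal (λ i → lookup-replicate i zeroE) (allFin N)

-- The zero homomorphism alone contributes N ^ k.
N^k≤γ : ∀ k N ds → N ^ k ≤ γ k N ds
N^k≤γ k N ds = begin
  N ^ k
    ≡⟨ cong (_^ k) (kerSize-zero N ds) ⟨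
  F 0⃗
    ≡⟨ *-identityˡ (F 0⃗) ⟨
  1 * F 0⃗
    ≡⟨ cong (_* F 0⃗) (𝟙-yes (isHom? N ds 0⃗) (zero-isHom N ds)) ⟨
  𝟙 (isHom? N ds 0⃗) * F 0⃗
    ≡⟨ ∑-pick (allVec-enumerates (allElem-enumerates (moduli ds)) N) (λ φ → 𝟙 (isHom? N ds φ) * F φ) 0⃗ ⟨
  ∑[ φ ∈ L ] 𝟙 (≡-dec _≟E_ φ 0⃗) * (𝟙 (isHom? N ds φ) * F φ)
    ≤⟨ ∑-mono (λ φ → 𝟙*≤ (≡-dec _≟E_ φ 0⃗) (𝟙 (isHom? N ds φ) * F φ)) L ⟩
  ∑[ φ ∈ L ] 𝟙 (isHom? N ds φ) * F φ
    ≡⟨ ∑-filter (isHom? N ds) F L ⟨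
  γ k N ds
    ∎
  where
  open ≤-Reasoning
  L : List (Vec (Carrier ds) N)
  L = allVec (allElem (moduli ds)) N
  0⃗ : Vec (Carrier ds) N
  0⃗ = replicate N zeroE
  F : Vec (Carrier ds) N → ℕ
  F φ = kerSize φ ^ k

module UpperBound {p : ℕ} (p-prime : Prime p) (r k : ℕ) (ds : Decomp) (valid : ValidDecomp ds) where

  private
    instance
      p≢0 : NonZero p
      p≢0 = prime⇒nonZero p-prime

  -- If φ(1) = h has order p^c then |ker φ|^k = (p^k)^(r∸c), the c-th term of this sum.
  weight : Carrier ds → ℕ
  weight h = horner (p ^ k) (λ b → 𝟙 ((p ^ b · h) ≟E zeroE)) r

  module _ {m : ℕ} (N≡p^r : 2 + m ≡ p ^ r) where

    private
      N = 2 + m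

    kerSize≤ : ∀ (φ : Vec (Carrier ds) N) {c} → (∀ x → lookup φ x ≡ zeroE → p ^ c ∣ toℕ x) → c ≤ r → kerSize φ ≤ p ^ (r ∸ c)
    kerSize≤ φ {c} ker⊆p^cℕ c≤r = begin
      kerSize φ                                  ≡⟨ length-filter (λ x → lookup φ x ≟E zeroE) (allFin N) ⟩
      ∑[ x ∈ allFin N ] 𝟙 (lookup φ x ≟E zeroE)  ≤⟨ ∑-mono (λ x → 𝟙-mono (lookup φ x ≟E zeroE) (p ^ c ∣? toℕ x) (ker⊆p^cℕ x)) (allFin N) ⟩
      ∑[ x ∈ allFin N ] 𝟙 (p ^ c ∣? toℕ x)       ≡⟨ ∑-allFin-toℕ N (λ x → 𝟙 (p ^ c ∣? x)) ⟩
      ∑[ x < N ] 𝟙 (p ^ c ∣? x)                  ≡⟨ cong (λ n → ∑[ x < n ] 𝟙 (p ^ c ∣? x)) N≡ ⟩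
      ∑[ x < p ^ (r ∸ c) * p ^ c ] 𝟙 (p ^ c ∣? x) ≤⟨ count-multiples≤ (p ^ c) {{m^n≢0 p c}} (p ^ (r ∸ c)) ⟩
      p ^ (r ∸ c)                                ∎
      where
      open ≤-Reasoning
      N≡ : N ≡ p ^ (r ∸ c) * p ^ c
      N≡ = trans N≡p^r (trans (cong (p ^_) (sym (m∸n+n≡m c≤r))) (^-distribˡ-+-* p (r ∸ c) c))

    kerSize^k≤weight : ∀ φ → IsHom N ds φ → kerSize φ ^ k ≤ weight (lookup φ (fsuc fzero))
    kerSize^k≤weight φ φ-hom = bound (order-exponent p generator r p^r·generator≡0)
      where
      open Homomorphism φ φ-hom
      p^r·generator≡0 : p ^ r · generator ≡ zeroE
      p^r·generator≡0 = subst (λ n → n · generator ≡ zeroE) N≡p^r N·generator≡0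
      bound : (Σ ℕ λ c → c ≤ r × OrderExponent p generator c) → kerSize φ ^ k ≤ weight generator
      bound (c , c≤r , order) = begin
        kerSize φ ^ k                                        ≤⟨ ^-monoˡ-≤ k (kerSize≤ φ ker⊆p^cℕ c≤r) ⟩
        (p ^ (r ∸ c)) ^ k                                    ≡⟨ ^-swap p (r ∸ c) k ⟩
        (p ^ k) ^ (r ∸ c)                                    ≡⟨ *-identityʳ _ ⟨
        (p ^ k) ^ (r ∸ c) * 1                                ≡⟨ cong ((p ^ k) ^ (r ∸ c) *_) p^c·generator≡0 ⟨
        (p ^ k) ^ (r ∸ c) * 𝟙 ((p ^ c · generator) ≟E zeroE) ≤⟨ horner-term (p ^ k) _ r c c≤r ⟩
        weight generator                                     ∎
        where
        open ≤-Reasoning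
        p^c·generator≡0 = 𝟙-yes ((p ^ c · generator) ≟E zeroE) (OrderExponent.kills order)
        ker⊆p^cℕ : ∀ x → lookup φ x ≡ zeroE → p ^ c ∣ toℕ x
        ker⊆p^cℕ x φx≡0 = order-exponent-∣ p-prime order (toℕ x) (trans (sym (φ-· x)) φx≡0)

    private
      E : List (Carrier ds)
      E = allElem (moduli ds)

      L : List (Vec (Carrier ds) N)
      L = allVec E N

      _≟V_ : DecidableEquality (Vec (Carrier ds) N)
      _≟V_ = ≡-dec _≟E_

      tab : Carrier ds → Vec (Carrier ds) N
      tab h = tabulate (λ i → toℕ i · h)

      F : Vec (Carrier ds) N → ℕ
      F φ = kerSize φ ^ k

    term≤∑weight : ∀ φ → 𝟙 (isHom? N ds φ) * F φ ≤ ∑[ h ∈ E ] 𝟙 (φ ≟V tab h) * weight h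
    term≤∑weight φ with isHom? N ds φ
    ... | no _      = z≤n
    ... | yes φ-hom = begin
      F φ + 0                            ≡⟨ +-identityʳ (F φ) ⟩
      F φ                                ≤⟨ kerSize^k≤weight φ φ-hom ⟩
      weight generator                   ≡⟨ ∑-pick (allElem-enumerates (moduli ds)) weight generator ⟨
      ∑[ h ∈ E ] 𝟙 (h ≟E generator) * weight h ≤⟨ ∑-mono (λ h → *-monoˡ-≤ (weight h) (𝟙-mono (h ≟E generator) (φ ≟V tab h) (φ≡tab h))) E ⟩
      ∑[ h ∈ E ] 𝟙 (φ ≟V tab h) * weight h ∎
      where
      open ≤-Reasoning
      open Homomorphism φ φ-hom
      φ≡tab : ∀ h → h ≡ generator → φ ≡ tab h
      φ≡tab h refl = φ≡tabulate

    γ≤∑weight : γ k N ds ≤ ∑[ h ∈ E ] weight h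
    γ≤∑weight = begin
      γ k N ds                                         ≡⟨ ∑-filter (isHom? N ds) F L ⟩
      ∑[ φ ∈ L ] 𝟙 (isHom? N ds φ) * F φ               ≤⟨ ∑-mono term≤∑weight L ⟩
      ∑[ φ ∈ L ] ∑[ h ∈ E ] 𝟙 (φ ≟V tab h) * weight h  ≡⟨ ∑-swap (λ φ h → 𝟙 (φ ≟V tab h) * weight h) L E ⟩
      ∑[ h ∈ E ] ∑[ φ ∈ L ] 𝟙 (φ ≟V tab h) * weight h  ≡⟨ ∑-cong (λ h → ∑-pick L-enumerates (λ _ → weight h) (tab h)) E ⟩
      ∑[ h ∈ E ] weight h                              ∎
      where
      open ≤-Reasoning
      L-enumerates = allVec-enumerates (allElem-enumerates (moduli ds)) N

  ∑weight≤horner : ∑[ h ∈ allElem (moduli ds) ] weight h ≤ horner (p ^ k) ((p ^ pRank p ds) ^_) r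
  ∑weight≤horner = begin
    ∑[ h ∈ allElem (moduli ds) ] weight h                  ≡⟨ ∑-horner (p ^ k) (λ h b → 𝟙 ((p ^ b · h) ≟E zeroE)) (allElem (moduli ds)) r ⟩
    horner (p ^ k) (λ b → #killed (p ^ b) (moduli ds)) r   ≤⟨ horner-mono (p ^ k) (λ b → #killed≤ p-prime b ds valid) r ⟩
    horner (p ^ k) (λ b → (p ^ b) ^ pRank p ds) r          ≤⟨ horner-mono (p ^ k) (λ b → ≤-reflexive (^-swap p b (pRank p ds))) r ⟩
    horner (p ^ k) ((p ^ pRank p ds) ^_) r                 ∎
    where open ≤-Reasoning

  γ≤horner : 1 ≤ r → γ k (p ^ r) ds ≤ horner (p ^ k) ((p ^ pRank p ds) ^_) r
  γ≤horner 1≤r = subst (λ N → γ k N ds ≤ horner (p ^ k) ((p ^ pRank p ds) ^_) r) 2+m≡p^r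
                       (≤-trans (γ≤∑weight 2+m≡p^r) ∑weight≤horner)
    where
    2≤p^r : 2 ≤ p ^ r
    2≤p^r = ≤-trans (nonTrivial⇒n>1 p {{prime⇒nonTrivial p-prime}}) (subst (_≤ p ^ r) (*-identityʳ p) (^-monoʳ-≤ p 1≤r))
    m = proj₁ (m≤n⇒∃[o]m+o≡n 2≤p^r)
    2+m≡p^r = proj₂ (m≤n⇒∃[o]m+o≡n 2≤p^r)

corollary3p3 : ∀ (p r : ℕ) → Prime p → 1 ≤ r →
               ∀ (ds : Decomp) → ValidDecomp ds →
               ∀ (t : ℕ) → pRank p ds ≡ t →
               ∀ (k : ℕ) → t < k →
               ((p ^ k ∸ 1) * p ^ (k * r) ≤ p ^ k * γ k (p ^ r) ds)
               × ((p ^ (k ∸ t) ∸ 1) * γ k (p ^ r) ds ≤ p ^ (k ∸ t) * p ^ (k * r))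
corollary3p3 p r p-prime 1≤r ds valid t refl k t<k = lower , upper
  where
  Q = p ^ (k ∸ t)
  p^[kr]≡[p^k]^r : p ^ (k * r) ≡ (p ^ k) ^ r
  p^[kr]≡[p^k]^r = sym (^-*-assoc p k r)
  p^k≡p^t*Q : p ^ k ≡ p ^ t * Q
  p^k≡p^t*Q = trans (cong (p ^_) (sym (m+[n∸m]≡n (<⇒≤ t<k)))) (^-distribˡ-+-* p t (k ∸ t))
  lower : (p ^ k ∸ 1) * p ^ (k * r) ≤ p ^ k * γ k (p ^ r) ds
  lower = begin
    (p ^ k ∸ 1) * p ^ (k * r) ≤⟨ *-monoˡ-≤ (p ^ (k * r)) (m∸n≤m (p ^ k) 1) ⟩
    p ^ k * p ^ (k * r)       ≡⟨ cong (p ^ k *_) (trans p^[kr]≡[p^k]^r (^-swap p k r)) ⟩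
    p ^ k * (p ^ r) ^ k       ≤⟨ *-monoʳ-≤ (p ^ k) (N^k≤γ k (p ^ r) ds) ⟩
    p ^ k * γ k (p ^ r) ds    ∎
    where open ≤-Reasoning
  upper : (Q ∸ 1) * γ k (p ^ r) ds ≤ Q * p ^ (k * r)
  upper = begin
    (Q ∸ 1) * γ k (p ^ r) ds                ≤⟨ *-monoʳ-≤ (Q ∸ 1) (UpperBound.γ≤horner p-prime r k ds valid 1≤r) ⟩
    (Q ∸ 1) * horner (p ^ k) ((p ^ t) ^_) r ≤⟨ geometric-bound (p ^ t) Q (p ^ k) r p^k≡p^t*Q (m^n>0 p {{prime⇒nonZero p-prime}} (k ∸ t)) ⟩
    Q * (p ^ k) ^ r                         ≡⟨ cong (Q *_) p^[kr]≡[p^k]^r ⟨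
    Q * p ^ (k * r)                         ∎
    where open ≤-Reasoning
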